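{- For all integers $n, d \ge 0$, the four sets $B_n(d)$, $B_d(n)$, $T_{n,d}$ and $T_{d,n}$ are pairwise in bijection (in particular $|B_n(d)| = |B_d(n)|$).
   Context: $B_n(d)$ is the set of points $(x_1,\dots,x_n) \in \mathbb{Z}^n$ with $\sum_{i=1}^n |x_i| \le d$ ($\mathbb{Z}^0$ is a single point). A tuple-sequence is a finite (possibly empty) list of signed tuples $[\pm(n_1,d_1), \pm(n_2,d_2), \ldots, \pm(n_k,d_k)]$, where each $n_i$ and $d_i$ is a positive integer and each tuple carries a sign $+$ or $-$. Its dimension sum is $\sum_i n_i$ and its distance sum is $\sum_i d_i$. $T_{n,d}$ is the set of tuple-sequences with dimension sum at most $n$ and distance sum at most $d$. -}

module Defs where

open import Data.Nat using (ℕ; suc; _+_; _≤_)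
open import Data.Integer using (ℤ; ∣_∣)
open import Data.Vec using (Vec; foldr)
open import Data.List using (List; map)
open import Data.Nat.ListAction using (sum)
open import Data.Product using (Σ; _×_; proj₁; proj₂)
open import Data.Sign using (Sign)

l1 : ∀ {n} → Vec ℤ n → ℕ
l1 = foldr _ (λ x acc → ∣ x ∣ + acc) 0

B : ℕ → ℕ → Set
B n d = Σ (Vec ℤ n) (λ x → l1 x ≤ d)

-- A signed tuple ±(n_i, d_i) with n_i, d_i positive integers;
-- positive integers are encoded as suc k, i.e. (s , a , b) means s(a+1, b+1).
SignedTuple : Set
SignedTuple = Sign × ℕ × ℕ

dimOf : SignedTuple → ℕ
dimOf t = suc (proj₁ (proj₂ t))

distOf : SignedTuple → ℕ
distOf t = suc (proj₂ (proj₂ t))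

TupleSeq : Set
TupleSeq = List SignedTuple

dimSum : TupleSeq → ℕ
dimSum ts = sum (map dimOf ts)

distSum : TupleSeq → ℕ
distSum ts = sum (map distOf ts)

T : ℕ → ℕ → Set
T n d = Σ TupleSeq (λ ts → dimSum ts ≤ n × distSum ts ≤ d)

module Submission where

-- Read a point of ℤⁿ from left to right: every nonzero coordinate x becomes the
-- tuple sign(x)(1 + number of zeros just before it, ∣x∣), and trailing zeros are
-- forgotten.  The dimension sum of the result is at most n and its distance sum is
-- the ℓ¹-norm, and a tuple-sequence of dimension sum at most n is recovered by
-- re-inserting the zeros, so B n d ≅ T n d.  Swapping the two entries of every
-- tuple gives T n d ≅ T d n, and the remaining bijections are composites.

open import Defs
open import Data.Nat using (ℕ; zero; suc; _+_; _≤_; z≤n; s≤s)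
open import Data.Nat.Properties using (≤-irrelevant; ≤-refl; ≤-trans)
open import Data.Integer using (ℤ; +_; -[1+_]; _◃_)
open import Data.Vec using (Vec; []; _∷_)
open import Data.List using ([]; _∷_; map)
open import Data.List.Properties using (map-∘; map-id)
open import Data.Nat.ListAction using (sum)
open import Data.Product using (Σ; _×_; _,_; proj₁)
open import Data.Sign using (Sign)
open import Function.Bundles using (_⤖_; _↔_; mk↔ₛ′)
open import Function.Properties.Inverse using (↔-sym; ↔-trans; ↔⇒⤖)
open import Level using (Level)
open import Relation.Binary.PropositionalEquality
open import Relation.Nullary.Irrelevant using (Irrelevant)

private
  variable
    a b p q : Level

Σ-≡-irrelevant : {A : Set a} {P : A → Set p} → (∀ x → Irrelevant (P x)) →
  {u v : Σ A P} → proj₁ u ≡ proj₁ v → u ≡ v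
Σ-≡-irrelevant P-irr {x , p} {.x , p′} refl = cong (x ,_) (P-irr x p p′)

Σ-↔ : {A : Set a} {A′ : Set b} {P : A → Set p} {Q : A′ → Set q} →
  (∀ x → Irrelevant (P x)) → (∀ y → Irrelevant (Q y)) →
  (f : A → A′) (g : A′ → A) →
  (∀ x → P x → Q (f x)) → (∀ y → Q y → P (g y)) →
  (∀ x → P x → g (f x) ≡ x) → (∀ y → Q y → f (g y) ≡ y) →
  Σ A P ↔ Σ A′ Q
Σ-↔ P-irr Q-irr f g f-Q g-P gf fg =
  mk↔ₛ′ (λ (x , px) → f x , f-Q x px) (λ (y , qy) → g y , g-P y qy)
        (λ (y , qy) → Σ-≡-irrelevant Q-irr (fg y qy))
        (λ (x , px) → Σ-≡-irrelevant P-irr (gf x px))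

B-irrelevant : ∀ n d (xs : Vec ℤ n) → Irrelevant (l1 xs ≤ d)
B-irrelevant n d xs = ≤-irrelevant

T-irrelevant : ∀ n d ts → Irrelevant (dimSum ts ≤ n × distSum ts ≤ d)
T-irrelevant n d ts (p , q) (p′ , q′) = cong₂ _,_ (≤-irrelevant p p′) (≤-irrelevant q q′)

padZero : TupleSeq → TupleSeq
padZero []                 = []
padZero ((s , k , a) ∷ ts) = (s , suc k , a) ∷ ts

encode : ∀ {n} → Vec ℤ n → TupleSeq
encode []               = []
encode (+ zero    ∷ xs) = padZero (encode xs)
encode (+ suc a   ∷ xs) = (Sign.+ , 0 , a) ∷ encode xs
encode (-[1+ a ]  ∷ xs) = (Sign.- , 0 , a) ∷ encode xs

-- Tuples beyond dimension n are dropped; on T n d this does not happen.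
decode : (n : ℕ) → TupleSeq → Vec ℤ n
decode zero    _                         = []
decode (suc n) []                        = + 0 ∷ decode n []
decode (suc n) ((s , suc k , a) ∷ ts)    = + 0 ∷ decode n ((s , k , a) ∷ ts)
decode (suc n) ((s , zero  , a) ∷ ts)    = (s ◃ suc a) ∷ decode n ts

encode-◃ : ∀ {n} s a (xs : Vec ℤ n) → encode ((s ◃ suc a) ∷ xs) ≡ (s , 0 , a) ∷ encode xs
encode-◃ Sign.+ a xs = refl
encode-◃ Sign.- a xs = refl

decode-padZero : ∀ n ts → decode (suc n) (padZero ts) ≡ + 0 ∷ decode n ts
decode-padZero n []      = refl
decode-padZero n (_ ∷ _) = refl

decode-encode : ∀ {n} (xs : Vec ℤ n) → decode n (encode xs) ≡ xs
decode-encode []                     = refl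
decode-encode {suc n} (+ zero ∷ xs)  =
  trans (decode-padZero n (encode xs)) (cong (+ 0 ∷_) (decode-encode xs))
decode-encode (+ suc a  ∷ xs)        = cong (_ ∷_) (decode-encode xs)
decode-encode (-[1+ a ] ∷ xs)        = cong (_ ∷_) (decode-encode xs)

encode-decode : ∀ n ts → dimSum ts ≤ n → encode (decode n ts) ≡ ts
encode-decode zero    []                      _       = refl
encode-decode (suc n) []                      _       = cong padZero (encode-decode n [] z≤n)
encode-decode (suc n) ((s , suc k , a) ∷ ts) (s≤s p) =
  cong padZero (encode-decode n ((s , k , a) ∷ ts) p)
encode-decode (suc n) ((s , zero , a) ∷ ts)  (s≤s p) =
  trans (encode-◃ s a (decode n ts)) (cong ((s , 0 , a) ∷_) (encode-decode n ts p))

dimSum-padZero : ∀ ts → dimSum (padZero ts) ≤ suc (dimSum ts)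
dimSum-padZero []      = z≤n
dimSum-padZero (_ ∷ _) = ≤-refl

distSum-padZero : ∀ ts → distSum (padZero ts) ≡ distSum ts
distSum-padZero []      = refl
distSum-padZero (_ ∷ _) = refl

dimSum-encode : ∀ {n} (xs : Vec ℤ n) → dimSum (encode xs) ≤ n
dimSum-encode []              = z≤n
dimSum-encode (+ zero   ∷ xs) = ≤-trans (dimSum-padZero (encode xs)) (s≤s (dimSum-encode xs))
dimSum-encode (+ suc a  ∷ xs) = s≤s (dimSum-encode xs)
dimSum-encode (-[1+ a ] ∷ xs) = s≤s (dimSum-encode xs)

distSum-encode : ∀ {n} (xs : Vec ℤ n) → distSum (encode xs) ≡ l1 xs
distSum-encode []              = refl
distSum-encode (+ zero   ∷ xs) = trans (distSum-padZero (encode xs)) (distSum-encode xs)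
distSum-encode (+ suc a  ∷ xs) = cong (λ m → suc (a + m)) (distSum-encode xs)
distSum-encode (-[1+ a ] ∷ xs) = cong (λ m → suc (a + m)) (distSum-encode xs)

B↔T : ∀ n d → B n d ↔ T n d
B↔T n d = Σ-↔ (B-irrelevant n d) (T-irrelevant n d) encode (decode n)
  (λ xs l1≤d → dimSum-encode xs , subst (_≤ d) (sym (distSum-encode xs)) l1≤d)
  (λ ts (dim≤n , dist≤d) → subst (_≤ d) (l1-decode ts dim≤n) dist≤d)
  (λ xs _ → decode-encode xs)
  (λ ts (dim≤n , _) → encode-decode n ts dim≤n)
  where
  l1-decode : ∀ ts → dimSum ts ≤ n → distSum ts ≡ l1 (decode n ts)
  l1-decode ts dim≤n = begin
    distSum ts                       ≡⟨ cong distSum (encode-decode n ts dim≤n) ⟨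
    distSum (encode (decode n ts))   ≡⟨ distSum-encode (decode n ts) ⟩
    l1 (decode n ts)                 ∎
    where open ≡-Reasoning

transpose-Tuple : SignedTuple → SignedTuple
transpose-Tuple (s , k , a) = (s , a , k)

dimSum-transpose : ∀ ts → dimSum (map transpose-Tuple ts) ≡ distSum ts
dimSum-transpose ts = cong sum (sym (map-∘ ts))

distSum-transpose : ∀ ts → distSum (map transpose-Tuple ts) ≡ dimSum ts
distSum-transpose ts = cong sum (sym (map-∘ ts))

transpose-involutive : ∀ ts → map transpose-Tuple (map transpose-Tuple ts) ≡ ts
transpose-involutive ts = trans (sym (map-∘ ts)) (map-id ts)

T↔T : ∀ n d → T n d ↔ T d n
T↔T n d = Σ-↔ (T-irrelevant n d) (T-irrelevant d n) (map transpose-Tuple) (map transpose-Tuple)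
  (transpose-T n d) (transpose-T d n)
  (λ ts _ → transpose-involutive ts) (λ ts _ → transpose-involutive ts)
  where
  transpose-T : ∀ n d ts → dimSum ts ≤ n × distSum ts ≤ d →
    dimSum (map transpose-Tuple ts) ≤ d × distSum (map transpose-Tuple ts) ≤ n
  transpose-T n d ts (dim≤n , dist≤d) =
    subst (_≤ d) (sym (dimSum-transpose ts)) dist≤d ,
    subst (_≤ n) (sym (distSum-transpose ts)) dim≤n

theorem9 : (n d : ℕ) →
    (B n d ⤖ B d n) × (B n d ⤖ T n d) × (B n d ⤖ T d n) ×
    (B d n ⤖ T n d) × (B d n ⤖ T d n) × (T n d ⤖ T d n)
theorem9 n d =
    ↔⇒⤖ (↔-trans (B↔T n d) (↔-trans (T↔T n d) (↔-sym (B↔T d n))))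
  , ↔⇒⤖ (B↔T n d)
  , ↔⇒⤖ (↔-trans (B↔T n d) (T↔T n d))
  , ↔⇒⤖ (↔-trans (B↔T d n) (T↔T d n))
  , ↔⇒⤖ (B↔T d n)
  , ↔⇒⤖ (T↔T n d)
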